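{- Let ${\tt L}$ be a linear graph. Then ${\tt L}\times{\tt I}_1$ decomposes into dynamical modules each of which is a caterpillar graph endowed with an alternating orientation; that is, the edge sets of the dynamical modules of ${\tt L}\times{\tt I}_1$ partition its edges, and each dynamical module has underlying undirected graph a caterpillar and every one of its vertices is a source or a sink in it.
   Context: A linear graph is a digraph (no bidirectional edges) whose underlying undirected graph is a path. ${\tt I}_1$ is the digraph with two vertices $w_0,w_1$ and one edge $(w_0,w_1)$. For digraphs ${\tt G},{\tt H}$, ${\tt G}\times{\tt H}$ is the digraph on $V({\tt G})\times V({\tt H})$ with edges $((u,w),(u',w))$ for each edge $(u,u')$ of ${\tt G}$ and $((u,w),(u,w'))$ for each edge $(w,w')$ of ${\tt H}$. A caterpillar graph is a tree obtained from a path $v_1,\dots,v_s$ by attaching some number $m_i\ge0$ of pendant leaves to each $v_i$. An orientation is alternating if every vertex has in-degree $0$ or out-degree $0$. A vertex is stable in a digraph ${\tt H}$ if its in-degree or out-degree in ${\tt H}$ is zero, and unstable otherwise. For ${\tt R}\le{\tt G}$, $C_{{\tt G}}({\tt R})$ is the subgraph spanned by $E({\tt G})\setminus E({\tt R})$ and $\partial_{{\tt G}}{\tt R}=V({\tt R})\cap V(C_{{\tt G}}({\tt R}))$. A dynamical region of ${\tt G}$ is a connected full (induced) subgraph ${\tt R}$ with at least one edge such that (a) every vertex of $\partial_{{\tt G}}{\tt R}$ is unstable in ${\tt G}$ but stable in both ${\tt R}$ and $C_{{\tt G}}({\tt R})$; (b) no edge of ${\tt R}$ lies on an oriented cycle of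 ${\tt G}$ not contained in ${\tt R}$. A dynamical module is a minimal dynamical region. -}

module Defs where

open import Data.Nat using (ℕ; suc)
open import Data.Fin using (Fin; inject₁) renaming (suc to fsuc)
open import Data.Bool using (Bool; true; false)
open import Data.Product using (Σ; ∃; _×_; _,_)
open import Data.Sum using (_⊎_)
open import Data.List using (List; []; _∷_; _++_; zip; [_])
open import Data.List.Relation.Unary.All using (All)
open import Data.List.Relation.Unary.Any using (Any)
open import Data.List.Relation.Unary.Unique.Propositional using (Unique)
open import Data.List.Membership.Propositional using (_∈_; _∉_)
open import Relation.Binary.PropositionalEquality using (_≡_)
open import Relation.Nullary using (¬_)
open import Data.Empty using (⊥)

record Digraph : Set₁ where
  field
    Vertex : Set
    Edge   : Vertex → Vertex → Set
open Digraph public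

-- Linear graph with n edges: vertices 0..n, the edge between i and i+1
-- points i → i+1 if o i ≡ true and i+1 → i if o i ≡ false.
Linear : (n : ℕ) → (Fin n → Bool) → Digraph
Linear n o = record
  { Vertex = Fin (suc n)
  ; Edge   = λ i j → Σ (Fin n) λ k →
        (o k ≡ true  × i ≡ inject₁ k × j ≡ fsuc k)
      ⊎ (o k ≡ false × i ≡ fsuc k × j ≡ inject₁ k)
  }

-- I₁ : vertices w₀ = false, w₁ = true, single edge (w₀ , w₁)
I₁ : Digraph
I₁ = record { Vertex = Bool ; Edge = λ a b → a ≡ false × b ≡ true }

_⊠_ : Digraph → Digraph → Digraph
G ⊠ H = record
  { Vertex = Vertex G × Vertex H
  ; Edge   = λ { (u , w) (u' , w') →
        (Edge G u u' × w ≡ w') ⊎ (u ≡ u' × Edge H w w') }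
  }

-- Notions relative to a fixed digraph G and a full (induced) subgraph R
-- given by its vertex set S (a full subgraph is determined by S).

module _ (G : Digraph) where

  VSet : Set
  VSet = Vertex G → Bool

  _∈ˢ_ : Vertex G → VSet → Set
  v ∈ˢ S = S v ≡ true

  EdgeIn : VSet → Vertex G → Vertex G → Set
  EdgeIn S u v = Edge G u v × u ∈ˢ S × v ∈ˢ S

  EdgeC : VSet → Vertex G → Vertex G → Set
  EdgeC S u v = Edge G u v × ¬ (u ∈ˢ S × v ∈ˢ S)

  StableWrt : (Vertex G → Vertex G → Set) → Vertex G → Set
  StableWrt E v = (∀ u → ¬ E u v) ⊎ (∀ u → ¬ E v u)

  StableG : Vertex G → Set
  StableG = StableWrt (Edge G)

  UnstableG : Vertex G → Set
  UnstableG v = ¬ StableG v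

  StableR : VSet → Vertex G → Set
  StableR S = StableWrt (EdgeIn S)

  StableC : VSet → Vertex G → Set
  StableC S = StableWrt (EdgeC S)

  Boundary : VSet → Vertex G → Set
  Boundary S v = v ∈ˢ S × ∃ λ u → EdgeC S u v ⊎ EdgeC S v u

  data UWalk (S : VSet) : Vertex G → Vertex G → Set where
    here : ∀ {v} → UWalk S v v
    step : ∀ {u w v} → (EdgeIn S u w ⊎ EdgeIn S w u) → UWalk S w v → UWalk S u v

  Connected : VSet → Set
  Connected S = ∀ u v → u ∈ˢ S → v ∈ˢ S → UWalk S u v

  HasEdge : VSet → Set
  HasEdge S = ∃ λ u → ∃ λ v → EdgeIn S u v

  cycEdges : List (Vertex G) → List (Vertex G × Vertex G)
  cycEdges []       = []
  cycEdges (v ∷ vs) = zip (v ∷ vs) (vs ++ [ v ])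

  IsCycle : List (Vertex G) → Set
  IsCycle []       = ⊥
  IsCycle (v ∷ vs) = Unique (v ∷ vs) × All (λ { (a , b) → Edge G a b }) (cycEdges (v ∷ vs))

  BothIn : VSet → Vertex G × Vertex G → Set
  BothIn S (a , b) = a ∈ˢ S × b ∈ˢ S

  DynamicalRegion : VSet → Set
  DynamicalRegion S =
      Connected S
    × HasEdge S
    × (∀ v → Boundary S v → UnstableG v × StableR S v × StableC S v)
    × (∀ c → IsCycle c →
         ¬ (Any (BothIn S) (cycEdges c) × ¬ All (BothIn S) (cycEdges c)))

  -- minimal dynamical region (w.r.t. the subgraph order, which for full
  -- subgraphs is inclusion of vertex sets)
  DynamicalModule : VSet → Set
  DynamicalModule S =
      DynamicalRegion S
    × (∀ S' → DynamicalRegion S' → (∀ v → v ∈ˢ S' → v ∈ˢ S) → ∀ v → v ∈ˢ S → v ∈ˢ S')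

  Adj : VSet → Vertex G → Vertex G → Set
  Adj S u v = EdgeIn S u v ⊎ EdgeIn S v u

  Consecutive : List (Vertex G) → Vertex G → Vertex G → Set
  Consecutive P u v = ∃ λ xs → ∃ λ ys → P ≡ xs ++ u ∷ v ∷ ys

  -- underlying undirected graph of R is a caterpillar: a path v₁ … v_s
  -- (s ≥ 1) of vertices of R, every other vertex of R is a leaf attached
  -- to a path vertex, and these are exactly the edges of R.
  Caterpillar : VSet → Set
  Caterpillar S = Σ (List (Vertex G)) λ P → Σ (Vertex G → Vertex G) λ att →
      (¬ P ≡ [])
    × Unique P
    × All (_∈ˢ S) P
    × (∀ u → u ∈ˢ S → u ∉ P → att u ∈ P)
    × (∀ u v → u ∈ˢ S → v ∈ˢ S →
         (Adj S u v →
            Consecutive P u v ⊎ Consecutive P v u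
          ⊎ (u ∉ P × v ≡ att u) ⊎ (v ∉ P × u ≡ att v))
       × (Consecutive P u v ⊎ Consecutive P v u
          ⊎ (u ∉ P × v ≡ att u) ⊎ (v ∉ P × u ≡ att v) → Adj S u v))

  Alternating : VSet → Set
  Alternating S = ∀ v → v ∈ˢ S → StableR S v

module Submission where

-- A dynamical region R is closed under replacing one of its edges by another edge with the same
-- tail (or head): otherwise that tail lies on the boundary of R with out-edges both in R and in its
-- complement, so it has no in-edges in either, and is stable in the whole graph. In L × I₁ the
-- classes of the equivalence generated by these moves are indexed by columns: a rung and an edge on
-- level w₀ belong to the class of their source column, an edge on level w₁ to that of its target
-- column, and columns i and i + 2 share a class exactly when vertex i + 1 is a source or a sink of
-- L. The vertices incident to a class span a full subgraph whose edges are exactly that class, no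
-- directed path of length two stays inside a class, and the graph is acyclic; so each class is a
-- dynamical region, minimal by the closure property, and every module is such a class. Ordered by
-- column and level, the vertices of a class form a path, apart from one pendant vertex on each rung
-- the path passes by: a caterpillar.

open import Defs
open import Data.Nat using (ℕ; zero; suc; pred; _+_; _∸_; _≤_; _<_; s≤s; z≤n; parity) renaming (_≟_ to _≟ℕ_)
open import Data.Nat.Properties
  using ( _≤?_; _<?_; ≤-refl; ≤-reflexive; ≤-trans; <-trans; <-irrefl; <-asym; <-cmp; <⇒≤; <⇒≱; <⇒≢
        ; n≤1+n; m<1+n⇒m≤n; 1+n≢n; m+1+n≢n; m≤n+m; pred[n]≤n; pred-mono-≤; pred[m∸n]≡m∸[1+n]
        ; ∸-monoʳ-≤; m<n⇒0<n∸m; +-suc; +-comm; +-mono-≤; +-monoˡ-≤; +-mono-<; +-monoˡ-<; +-monoʳ-<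
        ; module ≤-Reasoning )
open import Data.Fin as Fin using (Fin; toℕ; fromℕ<; inject₁)
open import Data.Fin.Properties
  using (toℕ-injective; toℕ-inject₁; toℕ<n; toℕ≤pred[n]; toℕ-fromℕ<; fromℕ<-toℕ)
open import Data.Bool using (Bool; true; false; not; if_then_else_; _xor_)
open import Data.Bool.Properties using (⇔→≡; not-¬; ¬-not; not-involutive) renaming (_≟_ to _≟ᵇ_)
open import Data.Parity.Base using (_⁻¹)
open import Data.Parity.Properties using (p≢p⁻¹; suc-homo-⁻¹)
open import Data.Product using (Σ; ∃; _×_; _,_; proj₁; proj₂)
open import Data.Product.Properties using (≡-dec)
open import Data.Sum using (_⊎_; inj₁; inj₂; swap) renaming ([_,_] to either)
open import Data.List using (List; []; _∷_; _++_; zip; [_])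
open import Data.List.Relation.Unary.All as All using (All; []; _∷_)
open import Data.List.Relation.Unary.Any using (here; there)
open import Data.List.Relation.Unary.AllPairs as AllPairs using ()
open import Data.List.Relation.Unary.Linked as Linked using (Linked; []; [-]; _∷_)
open import Data.List.Relation.Unary.Linked.Properties using (Linked⇒AllPairs; Linked⇒All)
open import Data.List.Relation.Unary.Unique.Propositional using (Unique)
open import Data.List.Membership.Propositional using (_∈_; _∉_)
open import Data.Empty using (⊥-elim)
open import Function using (_∘_)
open import Function.Bundles using (mk⇔)
open import Relation.Nullary using (¬_; Dec; yes; no; does; contradiction)
open import Relation.Nullary.Decidable using (_×-dec_; ¬?; dec-true)
open import Relation.Unary using (Decidable)
open import Relation.Binary.Definitions using (DecidableEquality; tri<; tri≈; tri>)
open import Relation.Binary.PropositionalEquality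
  using (_≡_; _≢_; refl; sym; trans; subst; cong; cong₂; module ≡-Reasoning)

data EdgeChain (G : Digraph) : Vertex G × Vertex G → Vertex G × Vertex G → Set where
  []       : ∀ {e} → EdgeChain G e e
  via-tail : ∀ {u v v′ e} → Edge G u v → Edge G u v′ → EdgeChain G (u , v′) e → EdgeChain G (u , v) e
  via-head : ∀ {u u′ v e} → Edge G u v → Edge G u′ v → EdgeChain G (u′ , v) e → EdgeChain G (u , v) e

module _ {G : Digraph} where

  private
    V = Vertex G
    E = Edge G

  EdgeChain-trans : ∀ {e e′ e″} → EdgeChain G e e′ → EdgeChain G e′ e″ → EdgeChain G e e″
  EdgeChain-trans []                 c = c
  EdgeChain-trans (via-tail p q c₁) c = via-tail p q (EdgeChain-trans c₁ c)
  EdgeChain-trans (via-head p q c₁) c = via-head p q (EdgeChain-trans c₁ c)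

  EdgeChain-sym : ∀ {e e′} → EdgeChain G e e′ → EdgeChain G e′ e
  EdgeChain-sym []               = []
  EdgeChain-sym (via-tail p q c) = EdgeChain-trans (EdgeChain-sym c) (via-tail q p [])
  EdgeChain-sym (via-head p q c) = EdgeChain-trans (EdgeChain-sym c) (via-head q p [])

  walk-++ : ∀ {S a b d} → UWalk G S a b → UWalk G S b d → UWalk G S a d
  walk-++ here       w = w
  walk-++ (step s w) w′ = step s (walk-++ w w′)

  walk-reverse : ∀ {S a b} → UWalk G S a b → UWalk G S b a
  walk-reverse here       = here
  walk-reverse (step s w) = walk-++ (walk-reverse w) (step (swap s) here)

  rank-acyclic : (rank : V → ℕ) → (∀ {u v} → E u v → rank u < rank v) → ∀ c → ¬ IsCycle G c
  rank-acyclic rank mono (v ∷ vs) (_ , edges) = <-irrefl refl (rank-grows v vs edges)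
    where
      rank-grows : ∀ x xs {y} → All (λ { (a , b) → E a b }) (zip (x ∷ xs) (xs ++ [ y ])) → rank x < rank y
      rank-grows x []       (e ∷ []) = mono e
      rank-grows x (z ∷ zs) (e ∷ es) = <-trans (mono e) (rank-grows z zs es)

  edge-split : ∀ S {u v} → E u v → EdgeIn G S u v ⊎ EdgeC G S u v
  edge-split S {u} {v} e with S u | S v
  ... | true  | true  = inj₁ (e , refl , refl)
  ... | false | _     = inj₂ (e , λ { (() , _) })
  ... | true  | false = inj₂ (e , λ { (_ , ()) })

  module _ {S : VSet G} (R : DynamicalRegion G S) where

    private
      boundary : ∀ v → Boundary G S v → UnstableG G v × StableR G S v × StableC G S v
      boundary = proj₁ (proj₂ (proj₂ R))

    region-tail-closed : ∀ {u v v′} → EdgeIn G S u v → E u v′ → EdgeIn G S u v′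
    region-tail-closed {u} (e , u∈S , v∈S) e′ with edge-split S e′
    ... | inj₁ e′∈S = e′∈S
    ... | inj₂ e′∉S with boundary u (u∈S , _ , inj₂ e′∉S)
    ...   | _ , inj₂ no-out-R , _ = ⊥-elim (no-out-R _ (e , u∈S , v∈S))
    ...   | _ , _ , inj₂ no-out-C = ⊥-elim (no-out-C _ e′∉S)
    ...   | unstable , inj₁ no-in-R , inj₁ no-in-C =
            ⊥-elim (unstable (inj₁ λ w e″ → either (no-in-R w) (no-in-C w) (edge-split S e″)))

    region-head-closed : ∀ {u u′ v} → EdgeIn G S u v → E u′ v → EdgeIn G S u′ v
    region-head-closed {v = v} (e , u∈S , v∈S) e′ with edge-split S e′
    ... | inj₁ e′∈S = e′∈S
    ... | inj₂ e′∉S with boundary v (v∈S , _ , inj₁ e′∉S)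
    ...   | _ , inj₁ no-in-R , _ = ⊥-elim (no-in-R _ (e , u∈S , v∈S))
    ...   | _ , _ , inj₁ no-in-C = ⊥-elim (no-in-C _ e′∉S)
    ...   | unstable , inj₂ no-out-R , inj₂ no-out-C =
            ⊥-elim (unstable (inj₂ λ w e″ → either (no-out-R w) (no-out-C w) (edge-split S e″)))

    region-chain-closed : ∀ {e e′} → EdgeChain G e e′ →
                          EdgeIn G S (proj₁ e) (proj₂ e) → EdgeIn G S (proj₁ e′) (proj₂ e′)
    region-chain-closed []               e∈S = e∈S
    region-chain-closed (via-tail _ q c) e∈S = region-chain-closed c (region-tail-closed e∈S q)
    region-chain-closed (via-head _ q c) e∈S = region-chain-closed c (region-head-closed e∈S q)

module _ {G : Digraph} {S S′ : VSet G} (S≗S′ : ∀ w → S w ≡ S′ w) where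

  private
    ⊆→ : ∀ {w} → S w ≡ true → S′ w ≡ true
    ⊆→ {w} w∈S = trans (sym (S≗S′ w)) w∈S
    ⊆← : ∀ {w} → S′ w ≡ true → S w ≡ true
    ⊆← {w} w∈S′ = trans (S≗S′ w) w∈S′
    edge→ : ∀ {u v} → EdgeIn G S u v → EdgeIn G S′ u v
    edge→ (e , u∈S , v∈S) = e , ⊆→ u∈S , ⊆→ v∈S
    edge← : ∀ {u v} → EdgeIn G S′ u v → EdgeIn G S u v
    edge← (e , u∈S′ , v∈S′) = e , ⊆← u∈S′ , ⊆← v∈S′
    adj→ : ∀ {u v} → Adj G S u v → Adj G S′ u v
    adj→ (inj₁ e) = inj₁ (edge→ e)
    adj→ (inj₂ e) = inj₂ (edge→ e)
    adj← : ∀ {u v} → Adj G S′ u v → Adj G S u v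
    adj← (inj₁ e) = inj₁ (edge← e)
    adj← (inj₂ e) = inj₂ (edge← e)

  Caterpillar-resp : Caterpillar G S → Caterpillar G S′
  Caterpillar-resp (P , att , nonempty , unique , P⊆S , attached , adjacency) =
    P , att , nonempty , unique , All.map ⊆→ P⊆S , (λ u u∈S′ → attached u (⊆← u∈S′)) ,
    λ u v u∈S′ v∈S′ → let (to , from) = adjacency u v (⊆← u∈S′) (⊆← v∈S′) in
      (λ a → to (adj← a)) , (λ shape → adj→ (from shape))

  Alternating-resp : Alternating G S → Alternating G S′
  Alternating-resp alt v v∈S′ with alt v (⊆← v∈S′)
  ... | inj₁ no-in  = inj₁ λ u e → no-in u (edge← e)
  ... | inj₂ no-out = inj₂ λ u e → no-out u (edge← e)

record ModuleLabelling (G : Digraph) : Set where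
  field
    label : Vertex G → Vertex G → ℕ
    class : ℕ → VSet G
    label-tail : ∀ {u v v′} → Edge G u v → Edge G u v′ → label u v ≡ label u v′
    label-head : ∀ {u u′ v} → Edge G u v → Edge G u′ v → label u v ≡ label u′ v
    label-path₂ : ∀ {u v w} → Edge G u v → Edge G v w → label u v ≢ label v w
    label-path₃ : ∀ {u v w x} → Edge G u v → Edge G v w → Edge G w x → label u v ≢ label w x
    class-incident : ∀ c w → class c w ≡ true →
      (∃ λ u → Edge G u w × label u w ≡ c) ⊎ (∃ λ u → Edge G w u × label w u ≡ c)
    class-endpoints : ∀ {u v} → Edge G u v → class (label u v) u ≡ true × class (label u v) v ≡ true
    label-chain : ∀ {u v u′ v′} → Edge G u v → Edge G u′ v′ → label u v ≡ label u′ v′ →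
      EdgeChain G (u , v) (u′ , v′)

module Classes {G : Digraph} (L : ModuleLabelling G) (acyclic : ∀ c → ¬ IsCycle G c) where

  open ModuleLabelling L

  private
    V = Vertex G
    E = Edge G

  class-full : ∀ c {u v} → class c u ≡ true → class c v ≡ true → E u v → label u v ≡ c
  class-full c {u} {v} u∈c v∈c e with class-incident c u u∈c | class-incident c v v∈c
  ... | inj₂ (_ , e₁ , l₁) | _                  = trans (label-tail e e₁) l₁
  ... | inj₁ _             | inj₁ (_ , e₂ , l₂) = trans (label-head e e₂) l₂
  ... | inj₁ (_ , e₁ , l₁) | inj₂ (_ , e₂ , l₂) = ⊥-elim (label-path₃ e₁ e e₂ (trans l₁ (sym l₂)))

  edge-in-class : ∀ {c u v} → E u v → label u v ≡ c → EdgeIn G (class c) u v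
  edge-in-class e refl = e , class-endpoints e

  class-edge-label : ∀ {c u v} → EdgeIn G (class c) u v → label u v ≡ c
  class-edge-label {c} (e , u∈c , v∈c) = class-full c u∈c v∈c e

  outside-label : ∀ {c u v} → EdgeC G (class c) u v → label u v ≢ c
  outside-label (e , ∉c) l = ∉c (proj₂ (edge-in-class e l))

  chain-walk : ∀ {c e e′} → EdgeChain G e e′ → label (proj₁ e) (proj₂ e) ≡ c →
               UWalk G (class c) (proj₁ e) (proj₁ e′)
  chain-walk []               l = here
  chain-walk (via-tail p q c) l = chain-walk c (trans (sym (label-tail p q)) l)
  chain-walk (via-head p q c) l =
    step (inj₁ (edge-in-class p l)) (step (inj₂ (edge-in-class q l′)) (chain-walk c l′))
    where l′ = trans (sym (label-head p q)) l

  incident-edge : ∀ c w → class c w ≡ true →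
    Σ (V × V) λ (a , b) → E a b × label a b ≡ c × UWalk G (class c) w a
  incident-edge c w w∈c with class-incident c w w∈c
  ... | inj₁ (u , e , l) = (u , w) , e , l , step (inj₂ (edge-in-class e l)) here
  ... | inj₂ (u , e , l) = (w , u) , e , l , here

  class-connected : ∀ c → Connected G (class c)
  class-connected c w₁ w₂ w₁∈c w₂∈c with incident-edge c w₁ w₁∈c | incident-edge c w₂ w₂∈c
  ... | _ , e₁ , l₁ , p₁ | _ , e₂ , l₂ , p₂ =
    walk-++ p₁ (walk-++ (chain-walk (label-chain e₁ e₂ (trans l₁ (sym l₂))) l₁) (walk-reverse p₂))

  source-no-in : ∀ {c u w y} → E w u → label w u ≡ c → ¬ EdgeIn G (class c) y w
  source-no-in e l e′ = label-path₂ (proj₁ e′) e (trans (class-edge-label e′) (sym l))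

  sink-no-out : ∀ {c u w y} → E u w → label u w ≡ c → ¬ EdgeIn G (class c) w y
  sink-no-out e l e′ = label-path₂ e (proj₁ e′) (trans l (sym (class-edge-label e′)))

  class-alternating : ∀ c → Alternating G (class c)
  class-alternating c w w∈c with class-incident c w w∈c
  ... | inj₁ (_ , e , l) = inj₂ λ _ → sink-no-out e l
  ... | inj₂ (_ , e , l) = inj₁ λ _ → source-no-in e l

  class-boundary : ∀ c w → Boundary G (class c) w →
                   UnstableG G w × StableR G (class c) w × StableC G (class c) w
  class-boundary c w (w∈c , x , out) with class-incident c w w∈c | out
  ... | inj₂ (u , e , l) | inj₂ (e′ , ∉c) = ⊥-elim (outside-label (e′ , ∉c) (trans (label-tail e′ e) l))
  ... | inj₂ (u , e , l) | inj₁ (e′ , ∉c) =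
        (λ { (inj₁ no-in) → no-in x e′ ; (inj₂ no-out) → no-out u e }) ,
        inj₁ (λ _ → source-no-in e l) ,
        inj₂ (λ y c′ → outside-label c′ (trans (label-tail (proj₁ c′) e) l))
  ... | inj₁ (u , e , l) | inj₁ (e′ , ∉c) = ⊥-elim (outside-label (e′ , ∉c) (trans (label-head e′ e) l))
  ... | inj₁ (u , e , l) | inj₂ (e′ , ∉c) =
        (λ { (inj₁ no-in) → no-in u e ; (inj₂ no-out) → no-out x e′ }) ,
        inj₂ (λ _ → sink-no-out e l) ,
        inj₁ (λ y c′ → outside-label c′ (trans (label-head (proj₁ c′) e) l))

  class-region : ∀ {u v} → E u v → DynamicalRegion G (class (label u v))
  class-region {u} {v} e =
    class-connected _ , (u , v , edge-in-class e refl) , class-boundary _ , λ c cyc _ → acyclic c cyc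

  class⊆region : ∀ {S} → DynamicalRegion G S → ∀ {u v} → EdgeIn G S u v →
                 ∀ w → class (label u v) w ≡ true → S w ≡ true
  class⊆region R {u} {v} e∈S w w∈c with class-incident (label u v) w w∈c
  ... | inj₁ (_ , e , l) = proj₂ (proj₂ (region-chain-closed R (label-chain (proj₁ e∈S) e (sym l)) e∈S))
  ... | inj₂ (_ , e , l) = proj₁ (proj₂ (region-chain-closed R (label-chain (proj₁ e∈S) e (sym l)) e∈S))

  class-module : ∀ {u v} → E u v → DynamicalModule G (class (label u v))
  class-module {u} {v} e = class-region e , minimal
    where
      minimal : ∀ S → DynamicalRegion G S → (∀ w → S w ≡ true → class (label u v) w ≡ true) →
                ∀ w → class (label u v) w ≡ true → S w ≡ true
      minimal S R@(_ , (a , b , e′ , a∈S , b∈S) , _) S⊆c w w∈c =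
        class⊆region R (e′ , a∈S , b∈S) w
          (subst (λ k → class k w ≡ true) (sym (class-edge-label (e′ , S⊆c a a∈S , S⊆c b b∈S))) w∈c)

  module-is-class : ∀ {S} → DynamicalModule G S → ∀ {u v} → EdgeIn G S u v →
                    ∀ w → S w ≡ class (label u v) w
  module-is-class {S} (R , minimal) {u} {v} e w = ⇔→≡ (mk⇔ S⊆class (class⊆region R e w))
    where
      S⊆class : S w ≡ true → class (label u v) w ≡ true
      S⊆class = minimal (class (label u v)) (class-region (proj₁ e)) (class⊆region R e) w

  decomposition : (∀ {u v} → E u v → Caterpillar G (class (label u v))) →
      (∀ u v → E u v → Σ (VSet G) λ S → DynamicalModule G S × EdgeIn G S u v)
    × (∀ S S′ → DynamicalModule G S → DynamicalModule G S′ →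
         ∀ u v → EdgeIn G S u v → EdgeIn G S′ u v → ∀ w → S w ≡ S′ w)
    × (∀ S → DynamicalModule G S → Caterpillar G S × Alternating G S)
  decomposition caterpillar =
    (λ u v e → class (label u v) , class-module e , edge-in-class e refl) ,
    (λ S S′ M M′ u v e e′ w → trans (module-is-class M e w) (sym (module-is-class M′ e′ w))) ,
    modules
    where
      modules : ∀ S → DynamicalModule G S → Caterpillar G S × Alternating G S
      modules S M@((_ , (a , b , e) , _) , _) =
        Caterpillar-resp class≗S (caterpillar (proj₁ e)) ,
        Alternating-resp class≗S (class-alternating (label a b))
        where
          class≗S : ∀ w → class (label a b) w ≡ S w
          class≗S w = sym (module-is-class M e w)

module Unfold {A : Set} (next : A → A) {P : A → Set} (P? : Decidable P) (position : A → ℕ) where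

  Advances : A → Set
  Advances u = P (next u) × position u < position (next u)

  advances? : Decidable Advances
  advances? u = P? (next u) ×-dec (position u <? position (next u))

  unfold : A → ℕ → List A
  unfold-after : (u : A) → ℕ → Dec (Advances u) → List A

  unfold u zero       = []
  unfold u (suc fuel) = u ∷ unfold-after u fuel (advances? u)

  unfold-after u fuel (yes _) = unfold (next u) fuel
  unfold-after u fuel (no _)  = []

  Succ : A → A → Set
  Succ a b = b ≡ next a × position a < position b

  unfold-All : ∀ {u} fuel → P u → All P (unfold u fuel)
  unfold-All {u} zero       Pu = []
  unfold-All {u} (suc fuel) Pu with advances? u
  ... | yes (Pn , _) = Pu ∷ unfold-All fuel Pn
  ... | no _         = Pu ∷ []

  unfold-Linked : ∀ u fuel → Linked Succ (unfold u fuel)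
  unfold-Linked u zero = []
  unfold-Linked u (suc fuel) with advances? u
  ... | no _ = [-]
  ... | yes (_ , u<n) with fuel
  ...   | zero      = [-]
  ...   | suc fuel′ = (refl , u<n) ∷ unfold-Linked (next u) (suc fuel′)

  unfold-reaches : ∀ u fuel {w} → w ∈ unfold u fuel → Advances w →
                   position (next w) < position u + fuel → next w ∈ unfold u fuel
  unfold-reaches u (suc fuel) (here refl) adv bound with advances? u
  ... | no ¬adv = contradiction adv ¬adv
  ... | yes (_ , u<n) with fuel
  ...   | zero   =
          contradiction (m<1+n⇒m≤n (subst (position (next u) <_) (+-comm (position u) 1) bound)) (<⇒≱ u<n)
  ...   | suc _  = there (here refl)
  unfold-reaches u (suc fuel) (there w∈) adv bound with advances? u
  ... | yes (_ , u<n) =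
        there (unfold-reaches (next u) fuel w∈ adv
          (≤-trans bound (≤-trans (≤-reflexive (+-suc (position u) fuel)) (+-monoˡ-≤ fuel u<n))))

  Linked-unique : ∀ {L} → Linked Succ L → Unique L
  Linked-unique L↑ =
    AllPairs.map (λ u<v u≡v → <-irrefl (cong position u≡v) u<v)
      (Linked⇒AllPairs <-trans (Linked.map proj₂ L↑))

  Linked-consecutive : ∀ {L} xs {u v} ys → Linked Succ L → L ≡ xs ++ u ∷ v ∷ ys → Succ u v
  Linked-consecutive []       ys L↑ refl = Linked.head L↑
  Linked-consecutive (x ∷ xs) ys L↑ refl = Linked-consecutive xs ys (Linked.tail L↑) refl

  above-head : ∀ {x L} → Linked Succ (x ∷ L) → All (λ y → position x < position y) L
  above-head [-]              = []
  above-head ((_ , x<y) ∷ L↑) = Linked⇒All <-trans x<y (Linked.map proj₂ L↑)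

  Linked-succ : ∀ {L u} → Linked Succ L → u ∈ L → next u ∈ L → position u < position (next u) →
                ∃ λ xs → ∃ λ ys → L ≡ xs ++ u ∷ next u ∷ ys
  Linked-succ _ (here refl) (here n≡u) u<n = ⊥-elim (<-irrefl (cong position (sym n≡u)) u<n)
  Linked-succ {x ∷ y ∷ L} ((refl , _) ∷ _) (here refl) (there _) _ = [] , L , refl
  Linked-succ L↑ (there u∈) (here n≡x) u<n =
    ⊥-elim (<-asym (All.lookup (above-head L↑) u∈) (subst (λ z → _ < position z) n≡x u<n))
  Linked-succ {x ∷ L} L↑ (there u∈) (there n∈) u<n with Linked-succ (Linked.tail L↑) u∈ n∈ u<n
  ... | xs , ys , L≡ = x ∷ xs , ys , cong (x ∷_) L≡

  module _ {s : A} (_≟_ : DecidableEquality A)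
           (predecessor : ∀ v → P v → v ≢ s → ∃ λ w → P w × next w ≡ v × position w < position v)
           {bound : ℕ} (position≤ : ∀ v → position v ≤ bound) where

    unfold-complete : ∀ v → P v → v ∈ unfold s (suc bound)
    unfold-complete v = reach (suc (position v)) v ≤-refl
      where
        within : ∀ v → position v < position s + suc bound
        within v = ≤-trans (s≤s (≤-trans (position≤ v) (m≤n+m bound (position s))))
                           (≤-reflexive (sym (+-suc (position s) bound)))

        reach : ∀ m v → position v < m → P v → v ∈ unfold s (suc bound)
        reach (suc m) v v<m Pv with v ≟ s
        ... | yes refl = here refl
        ... | no v≢s with predecessor v Pv v≢s
        ...   | w , Pw , refl , w<v =
                unfold-reaches s (suc bound) (reach m w (≤-trans w<v (m<1+n⇒m≤n v<m)) Pw) (Pv , w<v)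
                  (within (next w))

record SpineStructure (G : Digraph) (S : VSet G) : Set₁ where
  field
    OnSpine  : Vertex G → Set
    onSpine? : Decidable OnSpine
    _≟_      : DecidableEquality (Vertex G)
    next     : Vertex G → Vertex G
    position : Vertex G → ℕ
    bound    : ℕ
    position≤bound : ∀ v → position v ≤ bound
    start    : Vertex G
    start-onSpine  : OnSpine start
    onSpine⇒∈ : ∀ {v} → OnSpine v → S v ≡ true
    predecessor : ∀ v → OnSpine v → v ≢ start →
      ∃ λ w → OnSpine w × next w ≡ v × position w < position v
    adjacent⇒next : ∀ {u v} → OnSpine u → OnSpine v → Adj G S u v → position u < position v → next u ≡ v
    next-adjacent : ∀ {u} → S u ≡ true → S (next u) ≡ true → position u < position (next u) →
      Adj G S u (next u)
    adjacent⇒position≢ : ∀ {u v} → Adj G S u v → position u ≢ position v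
    attach : Vertex G → Vertex G
    attach-onSpine  : ∀ {u} → S u ≡ true → ¬ OnSpine u → OnSpine (attach u)
    attach-adjacent : ∀ {u} → S u ≡ true → ¬ OnSpine u → Adj G S u (attach u)
    attach-unique   : ∀ {u v} → S u ≡ true → ¬ OnSpine u → Adj G S u v → v ≡ attach u

spine-caterpillar : ∀ {G S} → SpineStructure G S → Caterpillar G S
spine-caterpillar {G} {S} spine =
  P , attach , P≢[] , Linked-unique P↑ , All.map onSpine⇒∈ (unfold-All (suc bound) start-onSpine) ,
  (λ u u∈S u∉P → ∈P (attach-onSpine u∈S (∉P⇒off u∉P))) ,
  λ u v u∈S v∈S → to u∈S v∈S , from u∈S v∈S
  where
    open SpineStructure spine
    open Unfold next onSpine? position

    P : List (Vertex G)
    P = unfold start (suc bound)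

    P↑ : Linked Succ P
    P↑ = unfold-Linked start (suc bound)

    ∈P : ∀ {v} → OnSpine v → v ∈ P
    ∈P = unfold-complete _≟_ predecessor position≤bound _

    ∈P⇒on : ∀ {v} → v ∈ P → OnSpine v
    ∈P⇒on = All.lookup (unfold-All (suc bound) start-onSpine)

    ∉P⇒off : ∀ {v} → v ∉ P → ¬ OnSpine v
    ∉P⇒off v∉P on = v∉P (∈P on)

    P≢[] : P ≢ []
    P≢[] P≡[] with subst (start ∈_) P≡[] (∈P start-onSpine)
    ... | ()

    Shape : Vertex G → Vertex G → Set
    Shape u v = Consecutive G P u v ⊎ Consecutive G P v u
              ⊎ (u ∉ P × v ≡ attach u) ⊎ (v ∉ P × u ≡ attach v)

    consecutive : ∀ {u v} → OnSpine u → OnSpine v → Adj G S u v → position u < position v →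
                  Consecutive G P u v
    consecutive {u} on-u on-v a u<v with adjacent⇒next on-u on-v a u<v
    ... | refl = Linked-succ P↑ (∈P on-u) (∈P on-v) u<v

    to : ∀ {u v} → S u ≡ true → S v ≡ true → Adj G S u v → Shape u v
    to {u} {v} u∈S v∈S a with onSpine? u | onSpine? v
    ... | no off-u | _      = inj₂ (inj₂ (inj₁ (off-u ∘ ∈P⇒on , attach-unique u∈S off-u a)))
    ... | yes _    | no off-v = inj₂ (inj₂ (inj₂ (off-v ∘ ∈P⇒on , attach-unique v∈S off-v (swap a))))
    ... | yes on-u | yes on-v with <-cmp (position u) (position v)
    ...   | tri< u<v _ _ = inj₁ (consecutive on-u on-v a u<v)
    ...   | tri≈ _ u≡v _ = ⊥-elim (adjacent⇒position≢ a u≡v)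
    ...   | tri> _ _ v<u = inj₂ (inj₁ (consecutive on-v on-u (swap a) v<u))

    consecutive-adjacent : ∀ {u v} → S u ≡ true → S v ≡ true → Consecutive G P u v → Adj G S u v
    consecutive-adjacent u∈S v∈S (xs , ys , P≡) with Linked-consecutive xs ys P↑ P≡
    ... | refl , u<v = next-adjacent u∈S v∈S u<v

    from : ∀ {u v} → S u ≡ true → S v ≡ true → Shape u v → Adj G S u v
    from u∈S v∈S (inj₁ c)                         = consecutive-adjacent u∈S v∈S c
    from u∈S v∈S (inj₂ (inj₁ c))                  = swap (consecutive-adjacent v∈S u∈S c)
    from u∈S v∈S (inj₂ (inj₂ (inj₁ (u∉P , refl)))) = attach-adjacent u∈S (∉P⇒off u∉P)
    from u∈S v∈S (inj₂ (inj₂ (inj₂ (v∉P , refl)))) = swap (attach-adjacent v∈S (∉P⇒off v∉P))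

extend : ∀ {n} → (Fin n → Bool) → ℕ → Bool
extend {zero}  o _       = false
extend {suc n} o zero    = o Fin.zero
extend {suc n} o (suc i) = extend (λ k → o (Fin.suc k)) i

extend-toℕ : ∀ {n} (o : Fin n → Bool) k → extend o (toℕ k) ≡ o k
extend-toℕ {suc n} o Fin.zero    = refl
extend-toℕ {suc n} o (Fin.suc k) = extend-toℕ (λ k → o (Fin.suc k)) k

module Ladder (n : ℕ) (o : Fin n → Bool) where

  G : Digraph
  G = Linear n o ⊠ I₁

  dir : ℕ → Bool
  dir = extend o

  dir-toℕ : ∀ k → dir (toℕ k) ≡ o k
  dir-toℕ = extend-toℕ o

  data Step : ℕ → ℕ → Set where
    forward  : ∀ {x} → x < n → dir x ≡ true  → Step x (suc x)
    backward : ∀ {x} → x < n → dir x ≡ false → Step (suc x) x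

  data Arc : ℕ → Bool → ℕ → Bool → Set where
    rung  : ∀ {x}     → Arc x false x true
    along : ∀ {x y b} → Step x y → Arc x b y b

  arc-view : ∀ {p b q b′} → Edge G (p , b) (q , b′) → Arc (toℕ p) b (toℕ q) b′
  arc-view (inj₂ (refl , refl , refl)) = rung
  arc-view (inj₁ ((k , inj₁ (ok , refl , refl)) , refl))
    rewrite toℕ-inject₁ k = along (forward (toℕ<n k) (trans (dir-toℕ k) ok))
  arc-view (inj₁ ((k , inj₂ (ok , refl , refl)) , refl))
    rewrite toℕ-inject₁ k = along (backward (toℕ<n k) (trans (dir-toℕ k) ok))

  private
    o-fromℕ< : ∀ {x b} (x<n : x < n) → dir x ≡ b → o (fromℕ< x<n) ≡ b
    o-fromℕ< x<n d = trans (sym (dir-toℕ _)) (trans (cong dir (toℕ-fromℕ< x<n)) d)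

    at-inject₁ : ∀ {x} {p : Fin (suc n)} (x<n : x < n) → toℕ p ≡ x → toℕ p ≡ toℕ (inject₁ (fromℕ< x<n))
    at-inject₁ x<n p≡x = trans p≡x (sym (trans (toℕ-inject₁ _) (toℕ-fromℕ< x<n)))

    at-fsuc : ∀ {x} {p : Fin (suc n)} (x<n : x < n) → toℕ p ≡ suc x → toℕ p ≡ toℕ (Fin.suc (fromℕ< x<n))
    at-fsuc x<n p≡1+x = trans p≡1+x (cong suc (sym (toℕ-fromℕ< x<n)))

  arc-edge : ∀ {x b y b′ p q} → Arc x b y b′ → toℕ p ≡ x → toℕ q ≡ y → Edge G (p , b) (q , b′)
  arc-edge rung p≡x q≡x = inj₂ (toℕ-injective (trans p≡x (sym q≡x)) , refl , refl)
  arc-edge (along (forward x<n d)) p≡x q≡1+x =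
    inj₁ ((fromℕ< x<n , inj₁ (o-fromℕ< x<n d , toℕ-injective (at-inject₁ x<n p≡x) ,
                                toℕ-injective (at-fsuc x<n q≡1+x))) , refl)
  arc-edge (along (backward x<n d)) p≡1+x q≡x =
    inj₁ ((fromℕ< x<n , inj₂ (o-fromℕ< x<n d , toℕ-injective (at-fsuc x<n p≡1+x) ,
                                toℕ-injective (at-inject₁ x<n q≡x))) , refl)


  cls : ℕ → ℕ
  cls zero          = zero
  cls (suc zero)    = suc zero
  cls (suc (suc i)) with dir i ≟ᵇ dir (suc i)
  ... | yes _ = suc (suc i)
  ... | no _  = cls i

  cls-cases : ∀ i → (dir i ≡ dir (suc i) × cls (suc (suc i)) ≡ suc (suc i))
                  ⊎ (dir i ≢ dir (suc i) × cls (suc (suc i)) ≡ cls i)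
  cls-cases i with dir i ≟ᵇ dir (suc i)
  ... | yes same = inj₁ (same , refl)
  ... | no turn  = inj₂ (turn , refl)

  cls-turn : ∀ i → dir i ≢ dir (suc i) → cls (suc (suc i)) ≡ cls i
  cls-turn i turn with cls-cases i
  ... | inj₁ (same , _) = contradiction same turn
  ... | inj₂ (_ , eq)   = eq

  cls-straight : ∀ i → dir i ≡ dir (suc i) → cls (suc (suc i)) ≡ suc (suc i)
  cls-straight i same with cls-cases i
  ... | inj₁ (_ , eq)    = eq
  ... | inj₂ (turn , _)  = contradiction same turn

  cls-≤ : ∀ x → cls x ≤ x
  cls-≤ zero          = z≤n
  cls-≤ (suc zero)    = ≤-refl
  cls-≤ (suc (suc i)) with dir i ≟ᵇ dir (suc i)
  ... | yes _ = ≤-refl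
  ... | no _  = ≤-trans (cls-≤ i) (≤-trans (n≤1+n i) (n≤1+n (suc i)))

  cls-idem : ∀ x → cls (cls x) ≡ cls x
  cls-idem zero          = refl
  cls-idem (suc zero)    = refl
  cls-idem (suc (suc i)) with dir i ≟ᵇ dir (suc i)
  ... | yes same = cls-straight i same
  ... | no _     = cls-idem i

  cls-parity : ∀ x → parity (cls x) ≡ parity x
  cls-parity zero          = refl
  cls-parity (suc zero)    = refl
  cls-parity (suc (suc i)) with dir i ≟ᵇ dir (suc i)
  ... | yes _ = refl
  ... | no _  = cls-parity i

  cls-suc : ∀ x → cls x ≢ cls (suc x)
  cls-suc x eq = p≢p⁻¹ (parity (suc x)) (begin
    parity (suc x)        ≡⟨ sym (cls-parity (suc x)) ⟩
    parity (cls (suc x))  ≡⟨ cong parity (sym eq) ⟩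
    parity (cls x)        ≡⟨ cls-parity x ⟩
    parity x              ≡⟨ sym (suc-homo-⁻¹ x) ⟩
    parity (suc x) ⁻¹     ∎)
    where open ≡-Reasoning

  cls-straight≢ : ∀ i → dir i ≡ dir (suc i) → cls i ≢ cls (suc (suc i))
  cls-straight≢ i same eq = <⇒≢ (s≤s (≤-trans (cls-≤ i) (n≤1+n i))) (trans eq (cls-straight i same))

  arcClass : ℕ → Bool → ℕ → ℕ
  arcClass x b y = if b then cls y else cls x

  private
    differ : ∀ {a b c : Bool} → a ≡ b → c ≡ not b → a ≢ c
    differ {b = b} a≡b c≡¬b a≡c = not-¬ {b} refl (trans (sym a≡b) (trans a≡c c≡¬b))

  into-top : ∀ {x b y} → Arc x b y true → arcClass x b y ≡ cls y
  into-top rung      = refl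
  into-top (along _) = refl

  step-cls≢ : ∀ {x y} → Step x y → cls x ≢ cls y
  step-cls≢ (forward {x} _ _)  = cls-suc x
  step-cls≢ (backward {y} _ _) = λ eq → cls-suc y (sym eq)

  step-tail : ∀ {x y y′} → Step x y → Step x y′ → cls y ≡ cls y′
  step-tail (forward _ _)   (forward _ _)   = refl
  step-tail (backward _ _)  (backward _ _)  = refl
  step-tail (forward _ d₁)  (backward _ d₂) = cls-turn _ (differ d₂ d₁)
  step-tail (backward _ d₁) (forward _ d₂)  = sym (cls-turn _ (differ d₁ d₂))

  step-head : ∀ {x x′ y} → Step x y → Step x′ y → cls x ≡ cls x′
  step-head (forward _ _)   (forward _ _)   = refl
  step-head (backward _ _)  (backward _ _)  = refl
  step-head (forward _ d₁)  (backward _ d₂) = sym (cls-turn _ (differ d₁ d₂))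
  step-head (backward _ d₁) (forward _ d₂)  = cls-turn _ (differ d₂ d₁)

  two-steps : ∀ {x y z} → Step x y → Step y z → cls x ≢ cls z
  two-steps (forward _ d₁)  (forward _ d₂)  = cls-straight≢ _ (trans d₁ (sym d₂))
  two-steps (backward _ d₁) (backward _ d₂) = λ eq → cls-straight≢ _ (trans d₂ (sym d₁)) (sym eq)
  two-steps (forward _ d₁)  (backward _ d₂) = contradiction (trans (sym d₁) d₂) λ ()
  two-steps (backward _ d₁) (forward _ d₂)  = contradiction (trans (sym d₁) d₂) λ ()

  arcClass-tail : ∀ {x b y β y′ β′} → Arc x b y β → Arc x b y′ β′ → arcClass x b y ≡ arcClass x b y′
  arcClass-tail {b = false} _        _        = refl
  arcClass-tail {b = true}  (along s) (along s′) = step-tail s s′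

  arcClass-head : ∀ {x b x′ b′ y β} → Arc x b y β → Arc x′ b′ y β → arcClass x b y ≡ arcClass x′ b′ y
  arcClass-head {β = true}  a         a′         = trans (into-top a) (sym (into-top a′))
  arcClass-head {β = false} (along s) (along s′) = step-head s s′

  arcClass-path₂ : ∀ {x b y β z γ} → Arc x b y β → Arc y β z γ → arcClass x b y ≢ arcClass y β z
  arcClass-path₂ rung                  (along s) = step-cls≢ s
  arcClass-path₂ {b = false} (along s) _         = step-cls≢ s
  arcClass-path₂ {b = true}  (along _) (along s) = step-cls≢ s

  arcClass-path₃ : ∀ {a α b β c γ d δ} → Arc a α b β → Arc b β c γ → Arc c γ d δ →
                   arcClass a α b ≢ arcClass c γ d
  arcClass-path₃ rung                   (along s₂) (along s₃) = two-steps s₂ s₃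
  arcClass-path₃ {α = false} (along s₁) rung       (along s₃) = two-steps s₁ s₃
  arcClass-path₃ {α = false} (along s₁) (along s₂) _          = two-steps s₁ s₂
  arcClass-path₃ {α = true}  (along _)  (along s₂) (along s₃) = two-steps s₂ s₃

  data Member (c : ℕ) : ℕ → Bool → Set where
    on-rung      : ∀ {x b} → cls x ≡ c → Member c x b
    on-left-arc  : ∀ {z b} → dir z ≡ not b → cls z ≡ c → Member c (suc z) b
    on-right-arc : ∀ {x b} → suc x ≤ n → dir x ≡ b → cls (suc x) ≡ c → Member c x b

  member? : ∀ c x b → Dec (Member c x b)
  member? c x b with cls x ≟ℕ c | suc x ≤? n ×-dec dir x ≟ᵇ b ×-dec cls (suc x) ≟ℕ c
  ... | yes e | _                = yes (on-rung e)
  ... | no _  | yes (lt , d , e) = yes (on-right-arc lt d e)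
  member? c zero    b | no ¬r | no ¬ra =
    no λ { (on-rung e) → ¬r e ; (on-right-arc lt d e) → ¬ra (lt , d , e) }
  member? c (suc z) b | no ¬r | no ¬ra with dir z ≟ᵇ not b ×-dec cls z ≟ℕ c
  ... | yes (d , e) = yes (on-left-arc d e)
  ... | no ¬la = no λ { (on-rung e) → ¬r e ; (on-left-arc d e) → ¬la (d , e)
                      ; (on-right-arc lt d e) → ¬ra (lt , d , e) }

  arc-members : ∀ {x b y b′} → Arc x b y b′ → Member (arcClass x b y) x b × Member (arcClass x b y) y b′
  arc-members rung                                = on-rung refl , on-rung refl
  arc-members {b = false} (along (forward _ d))   = on-rung refl , on-left-arc d refl
  arc-members {b = true}  (along (forward lt d))  = on-right-arc lt d refl , on-rung refl
  arc-members {b = false} (along (backward lt d)) = on-rung refl , on-right-arc lt d refl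
  arc-members {b = true}  (along (backward _ d))  = on-left-arc d refl , on-rung refl

  Incident : ℕ → ℕ → Bool → Set
  Incident c x b = (∃ λ y → ∃ λ b′ → y ≤ n × Arc y b′ x b × arcClass y b′ x ≡ c)
                 ⊎ (∃ λ y → ∃ λ b′ → y ≤ n × Arc x b y b′ × arcClass x b y ≡ c)

  member-incident : ∀ {c x b} → Member c x b → x ≤ n → Incident c x b
  member-incident {x = x} {false} (on-rung e)   x≤n = inj₂ (x , true , x≤n , rung , e)
  member-incident {x = x} {true}  (on-rung e)   x≤n = inj₁ (x , false , x≤n , rung , e)
  member-incident {x = suc z} {false} (on-left-arc d e) x≤n =
    inj₁ (z , false , <⇒≤ x≤n , along (forward x≤n d) , e)
  member-incident {x = suc z} {true} (on-left-arc d e) x≤n =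
    inj₂ (z , true , <⇒≤ x≤n , along (backward x≤n d) , e)
  member-incident {x = x} {false} (on-right-arc lt d e) _ =
    inj₁ (suc x , false , lt , along (backward lt d) , e)
  member-incident {x = x} {true}  (on-right-arc lt d e) _ =
    inj₂ (suc x , true , lt , along (forward lt d) , e)

  potential : ℕ → ℕ
  potential zero    = n
  potential (suc x) = if dir x then suc (potential x) else pred (potential x)

  potential-lower : ∀ x → n ∸ x ≤ potential x
  potential-lower zero = ≤-refl
  potential-lower (suc x) with dir x
  ... | true  = ≤-trans (∸-monoʳ-≤ n (n≤1+n x)) (≤-trans (potential-lower x) (n≤1+n _))
  ... | false = subst (_≤ pred (potential x)) (pred[m∸n]≡m∸[1+n] n x) (pred-mono-≤ (potential-lower x))

  step-potential : ∀ {x y} → Step x y → potential x < potential y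
  step-potential (forward {x} _ d) rewrite d = ≤-refl
  step-potential (backward {x} x<n d) rewrite d =
    pred< (potential x) (≤-trans (m<n⇒0<n∸m x<n) (potential-lower x))
    where
      pred< : ∀ m → 0 < m → pred m < m
      pred< (suc m) _ = ≤-refl

  rank : ℕ → Bool → ℕ
  rank x b = potential x + potential x + (if b then 1 else 0)

  arc-rank : ∀ {x b y b′} → Arc x b y b′ → rank x b < rank y b′
  arc-rank {x} rung = +-monoʳ-< (potential x + potential x) (s≤s z≤n)
  arc-rank {b = b} (along s) =
    +-monoˡ-< (if b then 1 else 0) (+-mono-< (step-potential s) (step-potential s))

  column : (x : ℕ) → .(x ≤ n) → Fin (suc n)
  column x x≤n = fromℕ< (s≤s x≤n)

  toℕ-column : ∀ x .(x≤n : x ≤ n) → toℕ (column x x≤n) ≡ x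
  toℕ-column x x≤n = toℕ-fromℕ< (s≤s x≤n)

  at-column : ∀ (P : ℕ → Set) {x} .(x≤n : x ≤ n) → P x → P (toℕ (column x x≤n))
  at-column P x≤n = subst P (sym (toℕ-column _ x≤n))

  step-arc : ∀ {x} → x < n → Step x (suc x) ⊎ Step (suc x) x
  step-arc {x} x<n with dir x in d
  ... | true  = inj₁ (forward x<n d)
  ... | false = inj₂ (backward x<n d)

  arc-edge-at : ∀ {x b y b′} .(x≤n : x ≤ n) .(y≤n : y ≤ n) → Arc x b y b′ →
                Edge G (column x x≤n , b) (column y y≤n , b′)
  arc-edge-at x≤n y≤n a = arc-edge a (toℕ-column _ x≤n) (toℕ-column _ y≤n)

  rung-edge : ∀ p → Edge G (p , false) (p , true)
  rung-edge p = arc-edge rung refl refl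

  rungOf : Fin (suc n) → Vertex G × Vertex G
  rungOf p = (p , false) , (p , true)

  rungAt : (x : ℕ) → .(x ≤ n) → Vertex G × Vertex G
  rungAt x x≤n = rungOf (column x x≤n)

  turn-chain : ∀ i (2+i≤n : suc (suc i) ≤ n) → dir i ≢ dir (suc i) →
               EdgeChain G (rungAt (suc (suc i)) 2+i≤n) (rungAt i (≤-trans (n≤1+n i) (<⇒≤ 2+i≤n)))
  turn-chain i 2+i≤n turn with dir i in d₀ | dir (suc i) in d₁
  ... | true  | true  = contradiction refl turn
  ... | false | false = contradiction refl turn
  ... | true  | false =
        via-tail (rung-edge _) back (via-head back fore (via-tail fore (rung-edge _) []))
    where
      back = arc-edge-at 2+i≤n (<⇒≤ 2+i≤n) (along (backward 2+i≤n d₁))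
      fore = arc-edge-at (≤-trans (n≤1+n i) (<⇒≤ 2+i≤n)) (<⇒≤ 2+i≤n) (along (forward (<⇒≤ 2+i≤n) d₀))
  ... | false | true =
        via-head (rung-edge _) fore (via-tail fore back (via-head back (rung-edge _) []))
    where
      fore = arc-edge-at (<⇒≤ 2+i≤n) 2+i≤n (along (forward 2+i≤n d₁))
      back = arc-edge-at (<⇒≤ 2+i≤n) (≤-trans (n≤1+n i) (<⇒≤ 2+i≤n)) (along (backward (<⇒≤ 2+i≤n) d₀))

  rung-chain : ∀ x (x≤n : x ≤ n) → EdgeChain G (rungAt x x≤n) (rungAt (cls x) (≤-trans (cls-≤ x) x≤n))
  rung-chain zero          _   = []
  rung-chain (suc zero)    _   = []
  rung-chain (suc (suc i)) x≤n with dir i ≟ᵇ dir (suc i)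
  ... | yes _    = []
  ... | no turn  = EdgeChain-trans (turn-chain i x≤n turn) (rung-chain i (≤-trans (n≤1+n i) (<⇒≤ x≤n)))

  rungAt-≡ : ∀ {x y} .{x≤n : x ≤ n} .{y≤n : y ≤ n} → x ≡ y → rungAt x x≤n ≡ rungAt y y≤n
  rungAt-≡ refl = refl

  label : Vertex G → Vertex G → ℕ
  label (p , b) (q , b′) = arcClass (toℕ p) b (toℕ q)

  top-stays-top : ∀ {x y b′} → Arc x true y b′ → b′ ≡ true
  top-stays-top (along _) = refl

  rungAt-toℕ : ∀ p → rungAt (toℕ p) (toℕ≤pred[n] p) ≡ rungOf p
  rungAt-toℕ p = cong rungOf (fromℕ<-toℕ p _)

  arc-to-rung : ∀ {u v} → Edge G u v →
    ∃ λ x → Σ (x ≤ n) λ x≤n → cls x ≡ label u v × EdgeChain G (u , v) (rungAt x x≤n)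
  arc-to-rung {p , false} e =
    toℕ p , toℕ≤pred[n] p , refl ,
    subst (EdgeChain G _) (sym (rungAt-toℕ p)) (via-tail e (rung-edge p) [])
  arc-to-rung {p , true} {q , b′} e with top-stays-top (arc-view e)
  ... | refl =
    toℕ q , toℕ≤pred[n] q , refl ,
    subst (EdgeChain G _) (sym (rungAt-toℕ q)) (via-head e (rung-edge q) [])

  label-chain : ∀ {u v u′ v′} → Edge G u v → Edge G u′ v′ → label u v ≡ label u′ v′ →
                EdgeChain G (u , v) (u′ , v′)
  label-chain {u′ = u′} {v′} e e′ same with arc-to-rung e | arc-to-rung e′
  ... | x , x≤n , cx , C | x′ , x′≤n , cx′ , C′ =
    EdgeChain-trans C (EdgeChain-trans (rung-chain x x≤n) (subst (λ r → EdgeChain G r (u′ , v′)) same-rung to-e′))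
    where
      to-e′ = EdgeChain-sym (EdgeChain-trans C′ (rung-chain x′ x′≤n))
      same-rung = rungAt-≡ {x≤n = ≤-trans (cls-≤ x′) x′≤n} {≤-trans (cls-≤ x) x≤n}
                           (trans cx′ (trans (sym same) (sym cx)))

  class : ℕ → VSet G
  class c (p , b) = does (member? c (toℕ p) b)

  member⇒class : ∀ {c p b} → Member c (toℕ p) b → class c (p , b) ≡ true
  member⇒class = dec-true (member? _ _ _)

  class⇒member : ∀ {c p b} → class c (p , b) ≡ true → Member c (toℕ p) b
  class⇒member {c} {p} {b} p∈c with member? c (toℕ p) b
  ... | yes m = m

  class-incident : ∀ c w → class c w ≡ true →
    (∃ λ u → Edge G u w × label u w ≡ c) ⊎ (∃ λ u → Edge G w u × label w u ≡ c)
  class-incident c (p , b) p∈c with member-incident (class⇒member p∈c) (toℕ≤pred[n] p)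
  ... | inj₁ (y , b′ , y≤n , a , l) =
        inj₁ ((column y y≤n , b′) , arc-edge a (toℕ-column y y≤n) refl ,
              trans (cong (λ k → arcClass k b′ (toℕ p)) (toℕ-column y y≤n)) l)
  ... | inj₂ (y , b′ , y≤n , a , l) =
        inj₂ ((column y y≤n , b′) , arc-edge a refl (toℕ-column y y≤n) ,
              trans (cong (arcClass (toℕ p) b) (toℕ-column y y≤n)) l)

  labelling : ModuleLabelling G
  labelling = record
    { label           = label
    ; class           = class
    ; label-tail      = λ e e′ → arcClass-tail (arc-view e) (arc-view e′)
    ; label-head      = λ e e′ → arcClass-head (arc-view e) (arc-view e′)
    ; label-path₂     = λ e e′ → arcClass-path₂ (arc-view e) (arc-view e′)
    ; label-path₃     = λ e e′ e″ → arcClass-path₃ (arc-view e) (arc-view e′) (arc-view e″)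
    ; class-incident  = class-incident
    ; class-endpoints = λ e → let (m , m′) = arc-members (arc-view e) in member⇒class m , member⇒class m′
    ; label-chain     = label-chain
    }

  acyclic : ∀ c → ¬ IsCycle G c
  acyclic = rank-acyclic (λ (p , b) → rank (toℕ p) b) (λ e → arc-rank (arc-view e))

  module ClassSpine (c : ℕ) (c-rep : cls c ≡ c) (c≤n : c ≤ n) where

    -- The spine of the class runs through its columns from left to right, entering column y on level
    -- entry y and leaving it towards column y + 1 on level exit y; position orders it.
    entry : ℕ → Bool
    entry x = dir (pred x)

    exit : ℕ → Bool
    exit y with y <? n
    ... | yes _ = not (dir y)
    ... | no _  = not (entry y)

    exit-< : ∀ {y} → y < n → exit y ≡ not (dir y)
    exit-< {y} y<n with y <? n
    ... | yes _   = refl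
    ... | no y≮n  = contradiction y<n y≮n

    entry₀≢exit₀ : entry 0 ≢ exit 0
    entry₀≢exit₀ with 0 <? n
    ... | yes _ = not-¬ refl
    ... | no _  = not-¬ refl

    Leaf : ℕ → Bool → Set
    Leaf y ℓ = cls y ≡ c × entry y ≡ exit y × ℓ ≡ not (entry y)

    OnSpine : ℕ → Bool → Set
    OnSpine y ℓ = Member c y ℓ × ¬ Leaf y ℓ

    Flip : ℕ → Bool → Set
    Flip y ℓ = cls y ≡ c × ℓ ≡ entry y × entry y ≢ exit y

    leaf? : ∀ y ℓ → Dec (Leaf y ℓ)
    leaf? y ℓ = cls y ≟ℕ c ×-dec entry y ≟ᵇ exit y ×-dec ℓ ≟ᵇ not (entry y)

    flip? : ∀ y ℓ → Dec (Flip y ℓ)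
    flip? y ℓ = cls y ≟ℕ c ×-dec ℓ ≟ᵇ entry y ×-dec ¬? (entry y ≟ᵇ exit y)

    Next : ℕ → Bool → ℕ → Bool → Set
    Next y ℓ z ℓ′ = (Flip y ℓ × z ≡ y × ℓ′ ≡ not ℓ) ⊎ (¬ Flip y ℓ × z ≡ suc y × ℓ′ ≡ ℓ)

    position : ℕ → Bool → ℕ
    position y ℓ = (if ℓ xor entry y then 1 else 0) + (y + y)

    ClassAdj : ℕ → Bool → ℕ → Bool → Set
    ClassAdj y ℓ z ℓ′ = (Arc y ℓ z ℓ′ × arcClass y ℓ z ≡ c) ⊎ (Arc z ℓ′ y ℓ × arcClass z ℓ′ y ≡ c)

    level-cases : ∀ y ℓ → (ℓ ≡ entry y × position y ℓ ≡ y + y)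
                        ⊎ (ℓ ≡ not (entry y) × position y ℓ ≡ suc (y + y))
    level-cases y ℓ with entry y
    level-cases y true  | true  = inj₁ (refl , refl)
    level-cases y false | true  = inj₂ (refl , refl)
    level-cases y true  | false = inj₂ (refl , refl)
    level-cases y false | false = inj₁ (refl , refl)

    position-≤ : ∀ y ℓ → position y ℓ ≤ suc (y + y)
    position-≤ y ℓ with level-cases y ℓ
    ... | inj₁ (_ , p) = ≤-trans (≤-reflexive p) (n≤1+n _)
    ... | inj₂ (_ , p) = ≤-reflexive p

    position-≥ : ∀ y ℓ → y + y ≤ position y ℓ
    position-≥ y ℓ with level-cases y ℓ
    ... | inj₁ (_ , p) = ≤-reflexive (sym p)
    ... | inj₂ (_ , p) = ≤-trans (n≤1+n _) (≤-reflexive (sym p))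

    position-suc : ∀ z ℓ ℓ′ → position z ℓ′ < position (suc z) ℓ
    position-suc z ℓ ℓ′ = begin-strict
      position z ℓ′      <⟨ s≤s (position-≤ z ℓ′) ⟩
      suc (suc (z + z))  ≡⟨ cong suc (sym (+-suc z z)) ⟩
      suc z + suc z      ≤⟨ position-≥ (suc z) ℓ ⟩
      position (suc z) ℓ ∎
      where open ≤-Reasoning

    position-rung : ∀ y ℓ ℓ′ → position y ℓ < position y ℓ′ → ℓ ≡ entry y × ℓ′ ≡ not (entry y)
    position-rung y ℓ ℓ′ lt with level-cases y ℓ | level-cases y ℓ′
    ... | inj₁ (e , _) | inj₂ (e′ , _) = e , e′
    ... | inj₁ (_ , p) | inj₁ (_ , p′) = ⊥-elim (<-irrefl (trans p (sym p′)) lt)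
    ... | inj₂ (_ , p) | _             =
          ⊥-elim (<⇒≱ lt (≤-trans (position-≤ y ℓ′) (≤-reflexive (sym p))))

    position-entry< : ∀ y → position y (entry y) < position y (not (entry y))
    position-entry< y with level-cases y (entry y) | level-cases y (not (entry y))
    ... | inj₁ (_ , p) | inj₂ (_ , p′) = ≤-reflexive (trans (cong suc p) (sym p′))
    ... | inj₂ (e , _) | _             = contradiction e (not-¬ refl)
    ... | _            | inj₁ (e , _)  = contradiction (sym e) (not-¬ refl)

    arc-position≢ : ∀ {x b y b′} → Arc x b y b′ → position x b ≢ position y b′
    arc-position≢ {x} rung eq with level-cases x false | level-cases x true
    ... | inj₁ (e , _) | inj₁ (e′ , _) = contradiction (trans e (sym e′)) λ ()
    ... | inj₂ (e , _) | inj₂ (e′ , _) = contradiction (trans e (sym e′)) λ ()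
    ... | inj₁ (_ , p) | inj₂ (_ , p′) = <-irrefl (trans (sym p) (trans eq p′)) (≤-refl)
    ... | inj₂ (_ , p) | inj₁ (_ , p′) = <-irrefl (trans (sym p′) (trans (sym eq) p)) ≤-refl
    arc-position≢ {b = b} {b′ = b′} (along (forward _ _))  eq = <⇒≢ (position-suc _ b′ b) eq
    arc-position≢ {b = b} {b′ = b′} (along (backward _ _)) eq = <⇒≢ (position-suc _ b b′) (sym eq)

    column-adjacency : ∀ {y ℓ z ℓ′} → cls y ≡ c → ClassAdj y ℓ z ℓ′ →
      (z ≡ y × ℓ′ ≡ not ℓ) ⊎ (z ≡ suc y × ℓ ≡ exit y) ⊎ (suc z ≡ y × ℓ ≡ entry y)
    column-adjacency _ (inj₁ (rung , _)) = inj₁ (refl , refl)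
    column-adjacency _ (inj₂ (rung , _)) = inj₁ (refl , refl)
    column-adjacency {ℓ = false} _ (inj₁ (along (forward lt d) , _)) =
      inj₂ (inj₁ (refl , sym (trans (exit-< lt) (cong not d))))
    column-adjacency {ℓ = true}  _ (inj₂ (along (backward lt d) , _)) =
      inj₂ (inj₁ (refl , sym (trans (exit-< lt) (cong not d))))
    column-adjacency {ℓ = false} _ (inj₁ (along (backward _ d) , _)) = inj₂ (inj₂ (refl , sym d))
    column-adjacency {ℓ = true}  _ (inj₂ (along (forward _ d) , _))  = inj₂ (inj₂ (refl , sym d))
    column-adjacency {y} {true}  cy (inj₁ (along (forward _ _) , l))      = ⊥-elim (cls-suc y (trans cy (sym l)))
    column-adjacency {y} {false} cy (inj₂ (along (backward _ _) , l))     = ⊥-elim (cls-suc y (trans cy (sym l)))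
    column-adjacency {_} {true}  cy (inj₁ (along (backward {w} _ _) , l)) = ⊥-elim (cls-suc w (trans l (sym cy)))
    column-adjacency {_} {false} cy (inj₂ (along (forward {w} _ _) , l))  = ⊥-elim (cls-suc w (trans l (sym cy)))

    rung-flip : ∀ {y ℓ ℓ′} → cls y ≡ c → OnSpine y ℓ′ → position y ℓ < position y ℓ′ → Flip y ℓ
    rung-flip {y} {ℓ} {ℓ′} cy (_ , ¬leaf) lt with position-rung y ℓ ℓ′ lt
    ... | ℓ≡entry , ℓ′≡other = cy , ℓ≡entry , λ same → ¬leaf (cy , same , ℓ′≡other)

    step-no-flip : ∀ {y ℓ ℓ′} → ClassAdj y ℓ (suc y) ℓ′ → ¬ Flip y ℓ
    step-no-flip {y} adj (cy , ℓ≡entry , turn) with column-adjacency cy adj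
    ... | inj₂ (inj₁ (_ , ℓ≡exit)) = turn (trans (sym ℓ≡entry) ℓ≡exit)
    ... | inj₁ (1+y≡y , _)         = 1+n≢n 1+y≡y
    ... | inj₂ (inj₂ (2+y≡y , _))  = m+1+n≢n 1 2+y≡y

    adjacent⇒next : ∀ {y ℓ z ℓ′} → OnSpine z ℓ′ → ClassAdj y ℓ z ℓ′ → position y ℓ < position z ℓ′ →
                    Next y ℓ z ℓ′
    adjacent⇒next on-z (inj₁ (rung , cy)) lt = inj₁ (rung-flip cy on-z lt , refl , refl)
    adjacent⇒next on-z (inj₂ (rung , cy)) lt = inj₁ (rung-flip cy on-z lt , refl , refl)
    adjacent⇒next _ adj@(inj₁ (along (forward _ _) , _))  _ = inj₂ (step-no-flip adj , refl , refl)
    adjacent⇒next _ adj@(inj₂ (along (backward _ _) , _)) _ = inj₂ (step-no-flip adj , refl , refl)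
    adjacent⇒next {ℓ = ℓ} {ℓ′ = ℓ′} _ (inj₁ (along (backward _ _) , _)) lt =
      ⊥-elim (<-asym lt (position-suc _ ℓ ℓ′))
    adjacent⇒next {ℓ = ℓ} {ℓ′ = ℓ′} _ (inj₂ (along (forward _ _) , _))  lt =
      ⊥-elim (<-asym lt (position-suc _ ℓ ℓ′))

    leaf-rung : ∀ {y ℓ} → Leaf y ℓ → ClassAdj y ℓ y (not ℓ)
    leaf-rung {ℓ = false} (cy , _) = inj₁ (rung , cy)
    leaf-rung {ℓ = true}  (cy , _) = inj₂ (rung , cy)

    leaf-partner-on-spine : ∀ {y ℓ} → Leaf y ℓ → OnSpine y (not ℓ)
    leaf-partner-on-spine {ℓ = ℓ} (cy , _ , ℓ≡other) =
      on-rung cy , λ (_ , _ , ¬ℓ≡other) → not-¬ refl (trans ℓ≡other (sym ¬ℓ≡other))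

    leaf-neighbour : ∀ {y ℓ z ℓ′} → Leaf y ℓ → ClassAdj y ℓ z ℓ′ → z ≡ y × ℓ′ ≡ not ℓ
    leaf-neighbour (cy , same , ℓ≡other) adj with column-adjacency cy adj
    ... | inj₁ rung-partner          = rung-partner
    ... | inj₂ (inj₁ (_ , ℓ≡exit))   = contradiction (trans same (trans (sym ℓ≡exit) ℓ≡other)) (not-¬ refl)
    ... | inj₂ (inj₂ (_ , ℓ≡entry))  = contradiction (trans (sym ℓ≡entry) ℓ≡other) (not-¬ refl)

    off-spine-leaf : ∀ {y ℓ} → Member c y ℓ → ¬ OnSpine y ℓ → Leaf y ℓ
    off-spine-leaf {y} {ℓ} m off with leaf? y ℓ
    ... | yes leaf = leaf
    ... | no ¬leaf = contradiction (m , ¬leaf) off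

    Predecessor : ℕ → Bool → Set
    Predecessor y ℓ = ∃ λ z → ∃ λ ℓ′ → OnSpine z ℓ′ × Next z ℓ′ y ℓ × position z ℓ′ < position y ℓ

    from-left : ∀ {z ℓ} → z < n → dir z ≡ not ℓ → cls z ≡ c → Predecessor (suc z) ℓ
    from-left {z} {ℓ} z<n d cz =
      z , ℓ , (on-rung cz , ¬leaf) , inj₂ (¬flip , refl , refl) , position-suc z ℓ ℓ
      where
        exit≡ℓ : exit z ≡ ℓ
        exit≡ℓ = trans (exit-< z<n) (trans (cong not d) (not-involutive ℓ))
        ¬leaf : ¬ Leaf z ℓ
        ¬leaf (_ , same , ℓ≡other) = not-¬ refl (trans ℓ≡other (cong not (trans same exit≡ℓ)))
        ¬flip : ¬ Flip z ℓ
        ¬flip (_ , ℓ≡entry , turn) = turn (trans (sym ℓ≡entry) (sym exit≡ℓ))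

    start : ℕ × Bool
    start = pred c , entry c

    start-on-spine : OnSpine (pred c) (entry c)
    start-on-spine = at c refl
      where
        at : ∀ k → k ≡ c → OnSpine (pred k) (entry k)
        at zero    refl = on-rung c-rep , λ (_ , same , _) → entry₀≢exit₀ same
        at (suc k) refl = on-right-arc c≤n refl c-rep , λ (ck , _) → cls-suc k (trans ck (sym c-rep))

    predecessor : ∀ {y ℓ} → y ≤ n → OnSpine y ℓ → (y , ℓ) ≢ start → Predecessor y ℓ
    predecessor y≤n (on-left-arc d cz , _) _ = from-left y≤n d cz
    predecessor {zero} {ℓ} _ (on-right-arc _ d e , _) not-start =
      contradiction (subst (λ k → (0 , ℓ) ≡ (pred k , entry k)) e (cong (0 ,_) (sym d))) not-start
    predecessor {suc t} {ℓ} _ (on-right-arc lt d e , _) not-start with cls-cases t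
    ... | inj₁ (_ , cls≡) =
          contradiction (subst (λ k → (suc t , ℓ) ≡ (pred k , entry k)) (trans (sym cls≡) e)
                                (cong (suc t ,_) (sym d)))
                        not-start
    ... | inj₂ (turn , cls≡) =
          from-left (≤-trans (n≤1+n (suc t)) lt) (trans (¬-not turn) (cong not d)) (trans (sym cls≡) e)
    predecessor {y} {ℓ} _ (on-rung cy , ¬leaf) _ with ℓ ≟ᵇ entry y
    ... | no ℓ≢entry =
          y , entry y , (on-rung cy , λ (_ , _ , e) → not-¬ refl e) ,
          inj₁ ((cy , refl , λ same → ¬leaf (cy , same , ¬-not ℓ≢entry)) , refl , ¬-not ℓ≢entry) ,
          subst (λ k → position y (entry y) < position y k) (sym (¬-not ℓ≢entry)) (position-entry< y)
    predecessor {suc z} {ℓ} y≤n (on-rung cy , _) _ | yes ℓ≡entry =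
          z , ℓ , (on-right-arc y≤n (sym ℓ≡entry) cy , λ (cz , _) → cls-suc z (trans cz (sym cy))) ,
          inj₂ ((λ (cz , _) → cls-suc z (trans cz (sym cy))) , refl , refl) , position-suc z ℓ ℓ
    predecessor {zero} {ℓ} _ (on-rung cy , _) not-start | yes ℓ≡entry =
          contradiction (subst (λ k → (0 , ℓ) ≡ (pred k , entry k)) cy (cong (0 ,_) ℓ≡entry)) not-start

    open Classes labelling acyclic using (class-edge-label; edge-in-class)

    Adjᶜ : Vertex G → Vertex G → Set
    Adjᶜ = Adj G (class c)

    adj⇒ClassAdj : ∀ {p ℓ q ℓ′} → Adjᶜ (p , ℓ) (q , ℓ′) → ClassAdj (toℕ p) ℓ (toℕ q) ℓ′
    adj⇒ClassAdj (inj₁ e) = inj₁ (arc-view (proj₁ e) , class-edge-label e)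
    adj⇒ClassAdj (inj₂ e) = inj₂ (arc-view (proj₁ e) , class-edge-label e)

    ClassAdj⇒adj : ∀ {p ℓ q ℓ′} → ClassAdj (toℕ p) ℓ (toℕ q) ℓ′ → Adjᶜ (p , ℓ) (q , ℓ′)
    ClassAdj⇒adj (inj₁ (a , l)) = inj₁ (edge-in-class (arc-edge a refl refl) l)
    ClassAdj⇒adj (inj₂ (a , l)) = inj₂ (edge-in-class (arc-edge a refl refl) l)

    -- At the last column p itself is returned, a junk value that positions never increase into.
    step-column : Fin (suc n) → Fin (suc n)
    step-column p with suc (toℕ p) ≤? n
    ... | yes lt = column (suc (toℕ p)) lt
    ... | no _   = p

    next : Vertex G → Vertex G
    next (p , ℓ) with flip? (toℕ p) ℓ
    ... | yes _ = p , not ℓ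
    ... | no _  = step-column p , ℓ

    next-≡ : ∀ {p ℓ q ℓ′} → Next (toℕ p) ℓ (toℕ q) ℓ′ → next (p , ℓ) ≡ (q , ℓ′)
    next-≡ {p} {ℓ} (inj₁ (flip , q≡p , refl)) with flip? (toℕ p) ℓ
    ... | yes _     = cong (_, not ℓ) (toℕ-injective (sym q≡p))
    ... | no ¬flip  = contradiction flip ¬flip
    next-≡ {p} {ℓ} {q} (inj₂ (¬flip , q≡1+p , refl)) with flip? (toℕ p) ℓ
    ... | yes flip = contradiction flip ¬flip
    ... | no _ with suc (toℕ p) ≤? n
    ...   | yes lt = cong (_, ℓ) (toℕ-injective (trans (toℕ-column _ lt) (sym q≡1+p)))
    ...   | no ¬lt = contradiction (subst (_≤ n) q≡1+p (toℕ≤pred[n] q)) ¬lt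

    next-adjacent : ∀ {u} → class c u ≡ true → class c (next u) ≡ true →
                    position (toℕ (proj₁ u)) (proj₂ u) < position (toℕ (proj₁ (next u))) (proj₂ (next u)) →
                    Adjᶜ u (next u)
    next-adjacent {p , ℓ} u∈c n∈c lt with flip? (toℕ p) ℓ
    next-adjacent {p , false} u∈c n∈c lt | yes _ = inj₁ (rung-edge p , u∈c , n∈c)
    next-adjacent {p , true}  u∈c n∈c lt | yes _ = inj₂ (rung-edge p , n∈c , u∈c)
    ... | no _ with suc (toℕ p) ≤? n
    ...   | no _   = ⊥-elim (<-irrefl refl lt)
    ...   | yes lt′ with step-arc lt′
    ...     | inj₁ s = inj₁ (arc-edge (along s) refl (toℕ-column _ lt′) , u∈c , n∈c)
    ...     | inj₂ s = inj₂ (arc-edge (along s) (toℕ-column _ lt′) refl , n∈c , u∈c)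

    OnSpineᵛ : Vertex G → Set
    OnSpineᵛ (p , ℓ) = OnSpine (toℕ p) ℓ

    positionᵛ : Vertex G → ℕ
    positionᵛ (p , ℓ) = position (toℕ p) ℓ

    pred-c≤n : pred c ≤ n
    pred-c≤n = ≤-trans pred[n]≤n c≤n

    startᵛ : Vertex G
    startᵛ = column (pred c) pred-c≤n , entry c

    next-source≤ : ∀ {z ℓ′ y ℓ} → Next z ℓ′ y ℓ → z ≤ y
    next-source≤ (inj₁ (_ , refl , _)) = ≤-refl
    next-source≤ (inj₂ (_ , refl , _)) = n≤1+n _

    predecessorᵛ : ∀ v → OnSpineᵛ v → v ≢ startᵛ →
                   ∃ λ w → OnSpineᵛ w × next w ≡ v × positionᵛ w < positionᵛ v
    predecessorᵛ (p , ℓ) on not-start with predecessor (toℕ≤pred[n] p) on not-startℕ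
      where
        not-startℕ : (toℕ p , ℓ) ≢ start
        not-startℕ eq = not-start (cong₂ _,_ p≡ (cong proj₂ eq))
          where p≡ = toℕ-injective (trans (cong proj₁ eq) (sym (toℕ-column _ pred-c≤n)))
    ... | z , ℓ′ , on-z , z→p , z<p =
          (column z z≤n′ , ℓ′) , at-column (λ k → OnSpine k ℓ′) z≤n′ on-z ,
          next-≡ (at-column (λ k → Next k ℓ′ (toℕ p) ℓ) z≤n′ z→p) ,
          at-column (λ k → position k ℓ′ < position (toℕ p) ℓ) z≤n′ z<p
      where z≤n′ = ≤-trans (next-source≤ z→p) (toℕ≤pred[n] p)

    attach-unique : ∀ {u v} → class c u ≡ true → ¬ OnSpineᵛ u → Adjᶜ u v → v ≡ (proj₁ u , not (proj₂ u))
    attach-unique u∈c off a with leaf-neighbour (off-spine-leaf (class⇒member u∈c) off) (adj⇒ClassAdj a)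
    ... | q≡p , refl = cong (_, _) (toℕ-injective q≡p)

    spine : SpineStructure G (class c)
    spine = record
      { OnSpine            = OnSpineᵛ
      ; onSpine?           = λ (p , ℓ) → member? c (toℕ p) ℓ ×-dec ¬? (leaf? (toℕ p) ℓ)
      ; _≟_                = ≡-dec Fin._≟_ _≟ᵇ_
      ; next               = next
      ; position           = positionᵛ
      ; bound              = suc (n + n)
      ; position≤bound     = λ (p , ℓ) → ≤-trans (position-≤ (toℕ p) ℓ)
                                           (s≤s (+-mono-≤ (toℕ≤pred[n] p) (toℕ≤pred[n] p)))
      ; start              = startᵛ
      ; start-onSpine      = at-column (λ k → OnSpine k (entry c)) pred-c≤n start-on-spine
      ; onSpine⇒∈          = λ on → member⇒class (proj₁ on)
      ; predecessor        = predecessorᵛ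
      ; adjacent⇒next      = λ _ on-v a lt → next-≡ (adjacent⇒next on-v (adj⇒ClassAdj a) lt)
      ; next-adjacent      = next-adjacent
      ; adjacent⇒position≢ = λ { (inj₁ e) → arc-position≢ (arc-view (proj₁ e))
                               ; (inj₂ e) eq → arc-position≢ (arc-view (proj₁ e)) (sym eq) }
      ; attach             = λ (p , ℓ) → p , not ℓ
      ; attach-onSpine     = λ u∈c off → leaf-partner-on-spine (off-spine-leaf (class⇒member u∈c) off)
      ; attach-adjacent    = λ u∈c off → ClassAdj⇒adj (leaf-rung (off-spine-leaf (class⇒member u∈c) off))
      ; attach-unique      = attach-unique
      }

  edge-class-caterpillar : ∀ {u v} → Edge G u v → Caterpillar G (class (label u v))
  edge-class-caterpillar e with arc-to-rung e
  ... | x , x≤n , cx≡ , _ =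
    subst (λ k → Caterpillar G (class k)) cx≡
      (spine-caterpillar (ClassSpine.spine (cls x) (cls-idem x) (≤-trans (cls-≤ x) x≤n)))

proposition4p24 : (n : ℕ) (o : Fin n → Bool) →
      (∀ u v → Edge (Linear n o ⊠ I₁) u v →
         Σ (VSet (Linear n o ⊠ I₁)) λ S →
           DynamicalModule (Linear n o ⊠ I₁) S × EdgeIn (Linear n o ⊠ I₁) S u v)
    × (∀ S S' → DynamicalModule (Linear n o ⊠ I₁) S → DynamicalModule (Linear n o ⊠ I₁) S' →
         ∀ u v → EdgeIn (Linear n o ⊠ I₁) S u v → EdgeIn (Linear n o ⊠ I₁) S' u v →
         ∀ w → S w ≡ S' w)
    × (∀ S → DynamicalModule (Linear n o ⊠ I₁) S →
         Caterpillar (Linear n o ⊠ I₁) S × Alternating (Linear n o ⊠ I₁) S)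
proposition4p24 n o = decomposition edge-class-caterpillar
  where
    open Ladder n o using (labelling; acyclic; edge-class-caterpillar)
    open Classes labelling acyclic using (decomposition)
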